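{- Let $G=(V,E)$ be a finite, simple, connected graph on $n$ vertices with minimum degree $\delta(G)\geq 3$ and vertex connectivity $\kappa(G)=1$. Then $F(G)\geq \left\lfloor \frac{n+1}{2}\right\rfloor$.
   Context: Zero forcing: given a graph $G=(V,E)$ and a set $S\subseteq V$ of "filled" vertices, the color change rule says that if a filled vertex $v$ has exactly one unfilled neighbor $w$, then $w$ becomes filled. The derived set of $S$ is the set of filled vertices obtained after applying this rule until no further application is possible. $S$ is a zero forcing set if its derived set is $V$; otherwise $S$ is a failed zero forcing set. The failed zero forcing number $F(G)$ is the maximum size of a failed zero forcing set of $G$. A vertex cut of a connected graph is a set of vertices whose removal leaves a disconnected or trivial graph; $\kappa(G)$ is the minimum size of a vertex cut. -}

module Defs where

open import Data.Nat using (ℕ; _≤_; _<_)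
open import Data.Fin using (Fin)
open import Data.Bool using (Bool; true; false; T)
open import Data.Vec using (tabulate)
open import Data.Fin.Subset using (Subset; _∈_; _∉_; ∣_∣; ⊥; ∁)
open import Data.Product using (Σ; ∃; _×_)
open import Data.Sum using (_⊎_)
open import Relation.Nullary using (¬_)
open import Relation.Binary.PropositionalEquality using (_≡_; _≢_)

record Graph (n : ℕ) : Set where
  field
    adj       : Fin n → Fin n → Bool
    symmetric : ∀ u v → adj u v ≡ adj v u
    irreflexive : ∀ v → adj v v ≡ false

module _ {n : ℕ} (G : Graph n) where
  open Graph G

  Adj : Fin n → Fin n → Set
  Adj u v = T (adj u v)

  N : Fin n → Subset n
  N v = tabulate (adj v)

  degree : Fin n → ℕ
  degree v = ∣ N v ∣

  MinDegreeAtLeast : ℕ → Set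
  MinDegreeAtLeast k = ∀ v → k ≤ degree v

  -- Reachability in G - X (the graph with the vertices of X deleted):
  -- walks whose vertices all lie outside X.
  data ReachAvoiding (X : Subset n) : Fin n → Fin n → Set where
    here : ∀ {u} → u ∉ X → ReachAvoiding X u u
    step : ∀ {u v w} → u ∉ X → Adj u v → ReachAvoiding X v w → ReachAvoiding X u w

  Connected : Set
  Connected = ∀ u v → ReachAvoiding ⊥ u v

  -- X is a vertex cut: G - X is disconnected or trivial (at most one vertex).
  IsVertexCut : Subset n → Set
  IsVertexCut X =
    (Σ (Fin n) λ u → Σ (Fin n) λ v → u ∉ X × v ∉ X × ¬ ReachAvoiding X u v)
    ⊎ (∣ ∁ X ∣ ≤ 1)

  VertexConnectivity≡ : ℕ → Set
  VertexConnectivity≡ k =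
    (Σ (Subset n) λ X → IsVertexCut X × ∣ X ∣ ≡ k)
    × (∀ X → IsVertexCut X → k ≤ ∣ X ∣)

  -- Derived set of S under the colour change rule: the least set containing S
  -- and closed under "a filled vertex u all of whose neighbours other than w are
  -- filled forces its neighbour w".
  data Filled (S : Subset n) : Fin n → Set where
    initial : ∀ {v} → v ∈ S → Filled S v
    force   : ∀ {u w} → Filled S u → Adj u w →
              (∀ x → Adj u x → x ≢ w → Filled S x) → Filled S w

  IsZeroForcingSet : Subset n → Set
  IsZeroForcingSet S = ∀ v → Filled S v

  IsFailedZeroForcingSet : Subset n → Set
  IsFailedZeroForcingSet S = ¬ IsZeroForcingSet S

  -- F(G) ≥ k : since F(G) is the maximum size of a failed zero forcing set,
  -- this holds iff some failed zero forcing set has size at least k.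
  FailedZFNumberAtLeast : ℕ → Set
  FailedZFNumberAtLeast k = Σ (Subset n) λ S → IsFailedZeroForcingSet S × k ≤ ∣ S ∣

-- Let c be a cut vertex, R a component of G - c and B the rest of G - c.
-- Since ∣R∣ + ∣B∣ < n, one of them, U, has at most ⌊n/2⌋ vertices, and c is
-- its only outside neighbour. If c has exactly one neighbour w in U, replace
-- U by U - w: as deg w ≥ 3, w keeps two neighbours in U - w. The resulting
-- nonempty set is a fort (every outside vertex adjacent to it has at least two
-- neighbours in it), so no vertex outside can ever force into it, and its
-- complement is a failed zero forcing set with at least n - ⌊n/2⌋ = ⌊(n+1)/2⌋
-- vertices.
module Submission where

open import Defs
open import Data.Nat using (ℕ; zero; suc; _+_; _∸_; _≤_; _<_; s≤s; z≤n; _≤?_; ⌊_/2⌋; ⌈_/2⌉)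
open import Data.Nat.Properties
  using (≤-trans; n≤1+n; ≤-reflexive; <-≤-trans; ≤⇒≯; <⇒≱; ≰⇒>; +-suc; +-mono-<; +-monoˡ-<;
         +-monoʳ-≤; m≤m+n; suc-injective; ∸-monoʳ-≤; m+[n∸m]≡n; m+n∸m≡n; ⌊n/2⌋+⌈n/2⌉≡n)
open import Data.Bool using (T)
open import Data.Fin using (Fin; zero; suc; _≟_)
open import Data.Fin.Properties using (any?)
open import Data.Fin.Subset
  using (Subset; inside; outside; _∈_; _∉_; ∣_∣; ∁; _∪_; _─_; _-_; ⁅_⁆; _⊆_; ⊥; Nonempty)
open import Data.Fin.Subset.Properties
  using (_∈?_; nonempty?; ⊆-refl; x∈⁅x⁆; x∈⁅y⁆⇒x≡y; x≢y⇒x∉⁅y⁆; x∉⁅y⁆⇒x≢y; p⊆p∪q; q⊆p∪q; x∈p∪q⁻;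
         x∈p∪q⁺; p⊂q⇒∣p∣<∣q∣; p⊆q⇒∣p∣≤∣q∣; ∣⁅x⁆∣≡1; ∣p∣≤n; ∣∁p∣≡n∸∣p∣; x∈∁p⇒x∉p;
         x∉∁p⇒x∈p; x∉p⇒x∈∁p; p─q⊆p; x∈p∧x∉q⇒x∈p─q; x∈p∧x≢y⇒x∈p-y)
open import Data.Vec using (_∷_; []; tabulate)
open import Data.Vec.Properties using (lookup∘tabulate; []=⇒lookup)
open import Data.Vec.Base using (here; there)
open import Data.Product using (∃; _×_; _,_; proj₁; proj₂; map)
open import Data.Sum using (_⊎_; inj₁; inj₂; [_,_]′)
open import Data.Empty using (⊥-elim)
open import Relation.Nullary using (¬_; Dec; yes; no; contradiction)
open import Relation.Nullary.Decidable using (T?; ¬?; _×-dec_; decidable-stable)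
open import Relation.Binary.PropositionalEquality
  using (_≡_; _≢_; refl; sym; trans; cong; cong₂; subst)
open import Data.Bool.Properties using (T-≡)
open import Function.Bundles using (Equivalence)

private
  variable
    n : ℕ

∣p∪q∣≤∣p∣+∣q∣ : (p q : Subset n) → ∣ p ∪ q ∣ ≤ ∣ p ∣ + ∣ q ∣
∣p∪q∣≤∣p∣+∣q∣ []            []            = z≤n
∣p∪q∣≤∣p∣+∣q∣ (inside ∷ p)  (inside ∷ q)  = s≤s (≤-trans (∣p∪q∣≤∣p∣+∣q∣ p q) (+-monoʳ-≤ ∣ p ∣ (n≤1+n _)))
∣p∪q∣≤∣p∣+∣q∣ (inside ∷ p)  (outside ∷ q) = s≤s (∣p∪q∣≤∣p∣+∣q∣ p q)
∣p∪q∣≤∣p∣+∣q∣ (outside ∷ p) (inside ∷ q)  rewrite +-suc ∣ p ∣ ∣ q ∣ = s≤s (∣p∪q∣≤∣p∣+∣q∣ p q)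
∣p∪q∣≤∣p∣+∣q∣ (outside ∷ p) (outside ∷ q) = ∣p∪q∣≤∣p∣+∣q∣ p q

∣p∣≡0⇒p≡⊥ : {p : Subset n} → ∣ p ∣ ≡ 0 → p ≡ ⊥
∣p∣≡0⇒p≡⊥ {p = []}          _  = refl
∣p∣≡0⇒p≡⊥ {p = outside ∷ p} eq = cong (outside ∷_) (∣p∣≡0⇒p≡⊥ eq)

∣p∣≡1⇒p≡⁅x⁆ : {p : Subset n} → ∣ p ∣ ≡ 1 → ∃ λ x → p ≡ ⁅ x ⁆
∣p∣≡1⇒p≡⁅x⁆ {p = inside ∷ p}  eq = zero , cong (inside ∷_) (∣p∣≡0⇒p≡⊥ (suc-injective eq))
∣p∣≡1⇒p≡⁅x⁆ {p = outside ∷ p} eq = map suc (cong (outside ∷_)) (∣p∣≡1⇒p≡⁅x⁆ eq)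

x∈p─q⇒x∉q : {p q : Subset n} {x : Fin n} → x ∈ p ─ q → x ∉ q
x∈p─q⇒x∉q {p = _ ∷ _} {inside ∷ _}  ()        here
x∈p─q⇒x∉q {p = _ ∷ _} {_ ∷ _}       (there m) (there x∈q) = x∈p─q⇒x∉q m x∈q

x∉p-x : (p : Subset n) (x : Fin n) → x ∉ p - x
x∉p-x p x x∈ = x∈p─q⇒x∉q x∈ (x∈⁅x⁆ x)

x∉p⇒∣p∣<∣p∪⁅x⁆∣ : {p : Subset n} {x : Fin n} → x ∉ p → ∣ p ∣ < ∣ p ∪ ⁅ x ⁆ ∣
x∉p⇒∣p∣<∣p∪⁅x⁆∣ {p = p} {x} x∉p = p⊂q⇒∣p∣<∣q∣ (p⊆p∪q _ , x , q⊆p∪q p _ (x∈⁅x⁆ x) , x∉p)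

∣p∣<∣q∣⇒Nonempty[q─p] : {p q : Subset n} → ∣ p ∣ < ∣ q ∣ → Nonempty (q ─ p)
∣p∣<∣q∣⇒Nonempty[q─p] {p = p} {q} ∣p∣<∣q∣ with nonempty? (q ─ p)
... | yes ne = ne
... | no empty = contradiction (p⊆q⇒∣p∣≤∣q∣ q⊆p) (<⇒≱ ∣p∣<∣q∣)
  where
  q⊆p : q ⊆ p
  q⊆p {x} x∈q = decidable-stable (x ∈? p) λ x∉p → empty (x , x∈p∧x∉q⇒x∈p─q x∈q x∉p)

∣p∣<∣q∣⇒∣p∣+∣∁q∣<n : (p q : Subset n) → ∣ p ∣ < ∣ q ∣ → ∣ p ∣ + ∣ ∁ q ∣ < n
∣p∣<∣q∣⇒∣p∣+∣∁q∣<n {n} p q ∣p∣<∣q∣ rewrite ∣∁p∣≡n∸∣p∣ q =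
  <-≤-trans (+-monoˡ-< (n ∸ ∣ q ∣) ∣p∣<∣q∣) (≤-reflexive (m+[n∸m]≡n (∣p∣≤n q)))

n≤1+2⌊n/2⌋ : ∀ n → n ≤ suc (⌊ n /2⌋ + ⌊ n /2⌋)
n≤1+2⌊n/2⌋ zero          = z≤n
n≤1+2⌊n/2⌋ (suc zero)    = s≤s z≤n
n≤1+2⌊n/2⌋ (suc (suc n)) rewrite +-suc ⌊ n /2⌋ ⌊ n /2⌋ = s≤s (s≤s (n≤1+2⌊n/2⌋ n))

a+b<n⇒a≤⌊n/2⌋⊎b≤⌊n/2⌋ : ∀ {a b} → a + b < n → a ≤ ⌊ n /2⌋ ⊎ b ≤ ⌊ n /2⌋
a+b<n⇒a≤⌊n/2⌋⊎b≤⌊n/2⌋ {n} {a} {b} a+b<n with a ≤? ⌊ n /2⌋ | b ≤? ⌊ n /2⌋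
... | yes a≤ | _      = inj₁ a≤
... | no _   | yes b≤ = inj₂ b≤
... | no a>  | no b>  =
  contradiction (≤-trans (s≤s (+-mono-< (≰⇒> a>) (≰⇒> b>))) a+b<n) (≤⇒≯ (n≤1+2⌊n/2⌋ n))

n∸⌊n/2⌋≡⌈n/2⌉ : ∀ n → n ∸ ⌊ n /2⌋ ≡ ⌈ n /2⌉
n∸⌊n/2⌋≡⌈n/2⌉ n = trans (cong (_∸ ⌊ n /2⌋) (sym (⌊n/2⌋+⌈n/2⌉≡n n))) (m+n∸m≡n ⌊ n /2⌋ ⌈ n /2⌉)

module _ (G : Graph n) where
  open Graph G

  Adj? : ∀ u v → Dec (Adj G u v)
  Adj? u v = T? (adj u v)

  ∈N⇒Adj : ∀ {v x} → x ∈ N G v → Adj G v x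
  ∈N⇒Adj {v} {x} m = Equivalence.from T-≡ (trans (sym (lookup∘tabulate (adj v) x)) ([]=⇒lookup m))

  Adj-sym : ∀ {u v} → Adj G u v → Adj G v u
  Adj-sym {u} {v} = subst T (symmetric u v)

  Adj⇒≢ : ∀ {u v} → Adj G u v → u ≢ v
  Adj⇒≢ {u} a refl = subst T (irreflexive u) a

  N⊆∁⁅v⁆ : ∀ v → N G v ⊆ ∁ ⁅ v ⁆
  N⊆∁⁅v⁆ v x∈N = x∉p⇒x∈∁p (x≢y⇒x∉⁅y⁆ (λ x≡v → Adj⇒≢ (∈N⇒Adj x∈N) (sym x≡v)))

  neighbourOutside : ∀ {w} (q : Subset n) → ∣ q ∣ < degree G w → ∃ λ x → Adj G w x × x ∉ q
  neighbourOutside {w} q ∣q∣<deg with ∣p∣<∣q∣⇒Nonempty[q─p] ∣q∣<deg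
  ... | x , x∈ = x , ∈N⇒Adj (p─q⊆p (N G w) q x∈) , x∈p─q⇒x∉q x∈

  ReachAvoiding-snoc : ∀ {X u r y} → ReachAvoiding G X u r → Adj G r y → y ∉ X → ReachAvoiding G X u y
  ReachAvoiding-snoc (here u∉X)       r~y y∉X = step u∉X r~y (here y∉X)
  ReachAvoiding-snoc (step u∉X u~v p) r~y y∉X = step u∉X u~v (ReachAvoiding-snoc p r~y y∉X)

  ReachAvoiding⇒∉ : ∀ {X u x} → ReachAvoiding G X u x → x ∉ X
  ReachAvoiding⇒∉ (here x∉X)   = x∉X
  ReachAvoiding⇒∉ (step _ _ p) = ReachAvoiding⇒∉ p

  Separates : Subset n → Subset n → Set
  Separates X U = ∀ {a b} → a ∉ U → a ∉ X → b ∈ U → ¬ Adj G a b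

  complement-separated : ∀ {X U} → Separates X U → Separates X (∁ (U ∪ X))
  complement-separated {X} {U} sep a∉ a∉X b∈ a~b with x∈p∪q⁻ U X (x∉∁p⇒x∈p a∉)
  ... | inj₁ a∈U = sep (λ b∈U → x∈∁p⇒x∉p b∈ (p⊆p∪q X b∈U))
                       (λ b∈X → x∈∁p⇒x∉p b∈ (q⊆p∪q U X b∈X)) a∈U (Adj-sym a~b)
  ... | inj₂ a∈X = a∉X a∈X

  record Component (X : Subset n) (u : Fin n) : Set where
    field
      vertices  : Subset n
      root∈     : u ∈ vertices
      reachable : ∀ {x} → x ∈ vertices → ReachAvoiding G X u x
      closed    : ∀ {r y} → r ∈ vertices → Adj G r y → y ∉ X → y ∈ vertices

  component-separated : ∀ {X u} (C : Component X u) → Separates X (Component.vertices C)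
  component-separated C a∉ a∉X b∈ a~b = a∉ (Component.closed C b∈ (Adj-sym a~b) a∉X)

  -- R grows by one reachable vertex per step; by n ≤ fuel + ∣R∣ the fuel runs out
  -- only when R is everything, so no vertex is left to add.
  growComponent : ∀ {X u} (fuel : ℕ) (R : Subset n) → n ≤ fuel + ∣ R ∣ → u ∈ R →
                  (∀ {x} → x ∈ R → ReachAvoiding G X u x) → Component X u
  growComponent {X} {u} fuel R bound u∈R reach
    with any? (λ r → any? (λ y → r ∈? R ×-dec (Adj? r y ×-dec (¬? (y ∈? X) ×-dec ¬? (y ∈? R)))))
  ... | no noExit = record { vertices = R ; root∈ = u∈R ; reachable = reach ; closed = closed }
    where
    closed : ∀ {r y} → r ∈ R → Adj G r y → y ∉ X → y ∈ R
    closed {r} {y} r∈R r~y y∉X =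
      decidable-stable (y ∈? R) λ y∉R → noExit (r , y , r∈R , r~y , y∉X , y∉R)
  ... | yes (r , y , r∈R , r~y , y∉X , y∉R) with fuel
  ...   | zero   = contradiction (≤-trans (∣p∣≤n (R ∪ ⁅ y ⁆)) bound) (<⇒≱ (x∉p⇒∣p∣<∣p∪⁅x⁆∣ y∉R))
  ...   | suc k  = growComponent k (R ∪ ⁅ y ⁆) bound′ (p⊆p∪q _ u∈R) reach′
    where
    bound′ : n ≤ k + ∣ R ∪ ⁅ y ⁆ ∣
    bound′ = ≤-trans bound
      (≤-trans (≤-reflexive (sym (+-suc k ∣ R ∣))) (+-monoʳ-≤ k (x∉p⇒∣p∣<∣p∪⁅x⁆∣ y∉R)))
    reach′ : ∀ {x} → x ∈ R ∪ ⁅ y ⁆ → ReachAvoiding G X u x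
    reach′ x∈ with x∈p∪q⁻ R _ x∈
    ... | inj₁ x∈R = reach x∈R
    ... | inj₂ x∈y =
      subst (ReachAvoiding G X u) (sym (x∈⁅y⁆⇒x≡y y x∈y)) (ReachAvoiding-snoc (reach r∈R) r~y y∉X)

  component : ∀ {X u} → u ∉ X → Component X u
  component {X} {u} u∉X = growComponent n ⁅ u ⁆ (m≤m+n n _) (x∈⁅x⁆ u)
    λ x∈ → subst (ReachAvoiding G X u) (sym (x∈⁅y⁆⇒x≡y u x∈)) (here u∉X)

  IsFort : Subset n → Set
  IsFort U = ∀ {a w} → a ∉ U → w ∈ U → Adj G a w → ∃ λ x → x ∈ U × Adj G a x × x ≢ w

  fort-unfilled : ∀ {U v} → IsFort U → Filled G (∁ U) v → v ∉ U
  fort-unfilled fort (initial v∈∁U) = x∈∁p⇒x∉p v∈∁U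
  fort-unfilled fort (force u-filled u~w others) w∈U with fort (fort-unfilled fort u-filled) w∈U u~w
  ... | x , x∈U , u~x , x≢w = fort-unfilled fort (others x u~x x≢w) x∈U

  fort⇒FailedZFNumberAtLeast : ∀ {U k} → IsFort U → Nonempty U → k ≤ n ∸ ∣ U ∣ →
                               FailedZFNumberAtLeast G k
  fort⇒FailedZFNumberAtLeast {U} fort (t , t∈U) k≤ =
    ∁ U , (λ zf → fort-unfilled fort (zf t) t∈U) , subst (_ ≤_) (sym (∣∁p∣≡n∸∣p∣ U)) k≤

  separated-fort : ∀ {c U} → Separates ⁅ c ⁆ U →
                   (∀ {w} → w ∈ U → Adj G c w → ∃ λ x → x ∈ U × Adj G c x × x ≢ w) → IsFort U
  separated-fort {c} sep other {a} a∉U w∈U a~w with a ≟ c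
  ... | yes refl = other w∈U a~w
  ... | no a≢c   = ⊥-elim (sep a∉U (x≢y⇒x∉⁅y⁆ a≢c) w∈U a~w)

  twoNeighboursBesides : MinDegreeAtLeast G 3 → ∀ w c →
                         ∃ λ x → ∃ λ y → Adj G w x × Adj G w y × x ≢ c × y ≢ c × x ≢ y
  twoNeighboursBesides deg w c with neighbourOutside ⁅ c ⁆ ∣⁅c⁆∣<deg
    where
    ∣⁅c⁆∣<deg : ∣ ⁅ c ⁆ ∣ < degree G w
    ∣⁅c⁆∣<deg = <-≤-trans (s≤s (≤-trans (≤-reflexive (∣⁅x⁆∣≡1 c)) (n≤1+n 1))) (deg w)
  ... | x , w~x , x∉ with neighbourOutside (⁅ c ⁆ ∪ ⁅ x ⁆) ∣⁅c⁆∪⁅x⁆∣<deg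
    where
    ∣⁅c⁆∪⁅x⁆∣<deg : ∣ ⁅ c ⁆ ∪ ⁅ x ⁆ ∣ < degree G w
    ∣⁅c⁆∪⁅x⁆∣<deg = ≤-trans (s≤s (≤-trans (∣p∪q∣≤∣p∣+∣q∣ ⁅ c ⁆ ⁅ x ⁆)
                     (≤-reflexive (cong₂ _+_ (∣⁅x⁆∣≡1 c) (∣⁅x⁆∣≡1 x))))) (deg w)
  ... | y , w~y , y∉ =
    x , y , w~x , w~y , x∉⁅y⁆⇒x≢y x∉ ,
    (λ y≡c → y∉ (x∈p∪q⁺ (inj₁ (subst (_∈ ⁅ c ⁆) (sym y≡c) (x∈⁅x⁆ c))))) ,
    (λ x≡y → y∉ (x∈p∪q⁺ (inj₂ (subst (_∈ ⁅ x ⁆) x≡y (x∈⁅x⁆ x)))))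

  separated-minus-fort : ∀ {c U w} → MinDegreeAtLeast G 3 → Separates ⁅ c ⁆ U → w ∈ U → Adj G c w →
                         (∀ {x} → x ∈ U → Adj G c x → x ≡ w) → IsFort (U - w) × Nonempty (U - w)
  separated-minus-fort {c} {U} {w} deg sep w∈U c~w unique with twoNeighboursBesides deg w c
  ... | x , y , w~x , w~y , x≢c , y≢c , x≢y = fort , x , inU w~x x≢c
    where
    inU : ∀ {z} → Adj G w z → z ≢ c → z ∈ U - w
    inU {z} w~z z≢c = x∈p∧x≢y⇒x∈p-y
      (decidable-stable (z ∈? U) λ z∉U → sep z∉U (x≢y⇒x∉⁅y⁆ z≢c) w∈U (Adj-sym w~z))
      (λ z≡w → Adj⇒≢ w~z (sym z≡w))
    fort : IsFort (U - w)
    fort {a} {w′} a∉ w′∈ a~w′ with a ≟ w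
    ... | yes refl with x ≟ w′
    ...   | no x≢w′ = x , inU w~x x≢c , w~x , x≢w′
    ...   | yes refl = y , inU w~y y≢c , w~y , λ y≡x → x≢y (sym y≡x)
    fort {a} {w′} a∉ w′∈ a~w′ | no a≢w with a ≟ c
    ...   | yes refl = ⊥-elim (x∉p-x U w (subst (_∈ U - w) (unique (p─q⊆p U _ w′∈) a~w′) w′∈))
    ...   | no a≢c   =
      ⊥-elim (sep (λ a∈U → a∉ (x∈p∧x≢y⇒x∈p-y a∈U a≢w)) (x≢y⇒x∉⁅y⁆ a≢c) (p─q⊆p U _ w′∈) a~w′)

  separated⇒fort : ∀ {c U} → MinDegreeAtLeast G 3 → Separates ⁅ c ⁆ U → Nonempty U →
                   ∃ λ F → IsFort F × Nonempty F × F ⊆ U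
  separated⇒fort {c} {U} deg sep ne with any? (λ w → w ∈? U ×-dec Adj? c w)
  ... | no noNeighbour =
    U , separated-fort sep (λ w∈U c~w → ⊥-elim (noNeighbour (_ , w∈U , c~w))) , ne , ⊆-refl
  ... | yes (w , w∈U , c~w) with any? (λ x → x ∈? U ×-dec (Adj? c x ×-dec ¬? (x ≟ w)))
  ...   | yes (x , x∈U , c~x , x≢w) = U , separated-fort sep other , ne , ⊆-refl
    where
    other : ∀ {w′} → w′ ∈ U → Adj G c w′ → ∃ λ z → z ∈ U × Adj G c z × z ≢ w′
    other {w′} _ _ with w ≟ w′
    ... | yes refl = x , x∈U , c~x , x≢w
    ... | no w≢w′  = w , w∈U , c~w , w≢w′
  ...   | no onlyW = U - w , proj₁ minus , proj₂ minus , p─q⊆p U _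
    where
    unique : ∀ {x} → x ∈ U → Adj G c x → x ≡ w
    unique {x} x∈U c~x = decidable-stable (x ≟ w) λ x≢w → onlyW (x , x∈U , c~x , x≢w)
    minus : IsFort (U - w) × Nonempty (U - w)
    minus = separated-minus-fort deg sep w∈U c~w unique

  separated⇒FailedZFNumberAtLeast : ∀ {c U} → MinDegreeAtLeast G 3 → Separates ⁅ c ⁆ U → Nonempty U →
                                    ∣ U ∣ ≤ ⌊ n /2⌋ → FailedZFNumberAtLeast G ⌈ n /2⌉
  separated⇒FailedZFNumberAtLeast deg sep ne ∣U∣≤ with separated⇒fort deg sep ne
  ... | F , fort , neF , F⊆U = fort⇒FailedZFNumberAtLeast fort neF
    (subst (_≤ n ∸ ∣ F ∣) (n∸⌊n/2⌋≡⌈n/2⌉ n) (∸-monoʳ-≤ n (≤-trans (p⊆q⇒∣p∣≤∣q∣ F⊆U) ∣U∣≤)))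

  cutVertex⇒FailedZFNumberAtLeast : ∀ {c} → MinDegreeAtLeast G 3 → IsVertexCut G ⁅ c ⁆ →
                                    FailedZFNumberAtLeast G ⌈ n /2⌉
  cutVertex⇒FailedZFNumberAtLeast {c} deg (inj₂ trivial) =
    contradiction (≤-trans (deg c) (≤-trans (p⊆q⇒∣p∣≤∣q∣ (N⊆∁⁅v⁆ c)) trivial)) λ { (s≤s ()) }
  cutVertex⇒FailedZFNumberAtLeast {c} deg (inj₁ (u , v , u∉ , v∉ , u↛v)) =
    [ separated⇒FailedZFNumberAtLeast deg sepR (u , root∈)
    , separated⇒FailedZFNumberAtLeast deg (complement-separated sepR) (v , v∈B)
    ]′ (a+b<n⇒a≤⌊n/2⌋⊎b≤⌊n/2⌋ ∣R∣+∣B∣<n)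
    where
    C : Component ⁅ c ⁆ u
    C = component u∉
    open Component C renaming (vertices to R)
    sepR : Separates ⁅ c ⁆ R
    sepR = component-separated C
    c∉R : c ∉ R
    c∉R c∈R = ReachAvoiding⇒∉ (reachable c∈R) (x∈⁅x⁆ c)
    ∣R∣+∣B∣<n : ∣ R ∣ + ∣ ∁ (R ∪ ⁅ c ⁆) ∣ < n
    ∣R∣+∣B∣<n = ∣p∣<∣q∣⇒∣p∣+∣∁q∣<n R (R ∪ ⁅ c ⁆) (x∉p⇒∣p∣<∣p∪⁅x⁆∣ c∉R)
    v∈B : v ∈ ∁ (R ∪ ⁅ c ⁆)
    v∈B = x∉p⇒x∈∁p λ v∈ → [ (λ v∈R → u↛v (reachable v∈R)) , v∉ ]′ (x∈p∪q⁻ R _ v∈)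

lemma2 : (n : ℕ) (G : Graph n) → Connected G → MinDegreeAtLeast G 3 →
    VertexConnectivity≡ G 1 → FailedZFNumberAtLeast G ⌊ suc n /2⌋
lemma2 n G _ deg ((X , cut , ∣X∣≡1) , _) with ∣p∣≡1⇒p≡⁅x⁆ {p = X} ∣X∣≡1
... | c , refl = cutVertex⇒FailedZFNumberAtLeast G deg cut
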